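{- Let $D$ be a distance on a set $X$ with $n\geq 1$ elements. Then the midpath split system satisfies $|\mathcal{S}_D|\leq n(n-1)$. Moreover, for all sufficiently large $n\in\mathbb{N}$ this bound is tight, i.e. there exists a distance $D$ on an $n$-element set $X$ with $|\mathcal{S}_D| = n(n-1)$.
   Context: A distance on a finite non-empty set $X$ is a symmetric map $D: X\times X\to\mathbb{R}$ with $D(x,x)=0$ and $D(x,y)\geq 0$ for all $x,y$. A split of $X$ is a bipartition $\{A,B\}$ of $X$ into two non-empty sets, written $A|B$. For $u\neq v$ in $X$ let $X_{u,v}=\{x\in X: D(u,x)<D(v,x)\}$. The midpath split system of $D$ is $\mathcal{S}_D=\{X_{u,v}|X-X_{u,v} : u,v\in X,\ u\neq v,\ \emptyset\subsetneq X_{u,v}\subsetneq X\}$.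
   Formalization: The distance D takes values in ℚ rather than ℝ. -}

module Defs where

open import Data.Nat using (ℕ; _*_; _∸_; _≤_)
open import Data.Fin using (Fin)
open import Data.Fin.Subset using (Subset; ∁; Nonempty)
open import Data.Vec using (tabulate)
open import Data.Rational using (ℚ; 0ℚ) renaming (_≤_ to _≤ℚ_)
open import Data.Rational.Properties using (_<?_)
open import Data.List using (List; length)
open import Data.List.Relation.Unary.All using (All)
open import Data.List.Relation.Unary.Any using (Any)
open import Data.List.Relation.Unary.AllPairs using (AllPairs)
open import Data.Product using (Σ; ∃; ∃-syntax; _×_)
open import Data.Sum using (_⊎_)
open import Relation.Nullary using (¬_; does)
open import Relation.Binary.PropositionalEquality using (_≡_; _≢_)

record IsDistance {n : ℕ} (D : Fin n → Fin n → ℚ) : Set where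
  field
    symmetric : ∀ x y → D x y ≡ D y x
    zero-diag : ∀ x → D x x ≡ 0ℚ
    nonneg    : ∀ x y → 0ℚ ≤ℚ D x y

Xuv : {n : ℕ} → (Fin n → Fin n → ℚ) → Fin n → Fin n → Subset n
Xuv D u v = tabulate (λ x → does (D u x <? D v x))

-- A split A|B of Fin n is represented by either of its parts (a subset A);
-- two representatives denote the same split iff A ≡ A' or A ≡ ∁ A'.
SameSplit : {n : ℕ} → Subset n → Subset n → Set
SameSplit A A' = (A ≡ A') ⊎ (A ≡ ∁ A')

InMidpath : {n : ℕ} → (Fin n → Fin n → ℚ) → Subset n → Set
InMidpath D A = ∃[ u ] ∃[ v ] (u ≢ v × Nonempty (Xuv D u v) × Nonempty (∁ (Xuv D u v))
                               × SameSplit A (Xuv D u v))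

-- |S_D| = k : there is a list of k representatives of pairwise distinct splits of S_D,
-- and every split of S_D is represented in the list.
MidpathCard : {n : ℕ} → (Fin n → Fin n → ℚ) → ℕ → Set
MidpathCard D k = Σ (List _) λ As →
    length As ≡ k
  × All (InMidpath D) As
  × AllPairs (λ A A' → ¬ SameSplit A A') As
  × (∀ A → InMidpath D A → Any (SameSplit A) As)

{-# OPTIONS --safe #-}

-- Upper bound: every split of S_D is X_{u,v} | X − X_{u,v} for one of the n(n − 1) ordered pairs
-- of distinct points, so discarding trivial sets and repetitions from that list leaves at most
-- n(n − 1) splits, whatever D is.
--
-- Lower bound: on {0, …, n − 1} let D(x, y) = g ∣x − y∣ with g = 0, 4, 3, 2, 1, 1, …. Then X_{u,v}
-- consists of u and of the points x ≠ v with ∣x − v∣ ≤ 3 that are strictly nearer to v than to u.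
-- For n ≥ 23 these sets are pairwise distinct and never complementary. When u, v, u′, v′ lie in 13
-- consecutive points, distinctness is a finite check, as X_{u,v} is translation invariant. Otherwise
-- either u ≠ u′ and ∣v − v′∣ ≥ 7: then X_{u,v} ⊆ {u, u′}, which forces v to an end of {0, …, n − 1}
-- (both neighbours of an interior v lie in X_{u,v}), and at that end two points of X_{u,v} differ
-- from u. Or u = u′ lies at distance ≥ 7 from v′: then X_{u,v′} contains the punctured 3-ball
-- around v′, which must fit into the one around v, so v′ is an end point with ∣v − v′∣ = 4, and the
-- neighbour of v away from v′ lies in X_{u,v} but not in X_{u,v′}. Finally, among three consecutive
-- points at distance > 3 from v and v′ one avoids u and u′, and so lies in neither set.

module Submission where

open import Defs
open import Data.Bool using (Bool; true; false; T; not; _∧_; _∨_; _xor_)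
open import Data.Bool.ListAction using (all; any)
open import Data.Bool.Properties using (T-≡; T-∧; T-∨; xor-same; not-involutive) renaming (_≟_ to _≟ᵇ_)
open import Data.Empty using (⊥; ⊥-elim)
open import Data.Fin using (Fin; toℕ; fromℕ<; punchIn; punchOut)
open import Data.Fin.Properties
  using (toℕ<n; toℕ-injective; toℕ-fromℕ<; punchIn-injective; punchInᵢ≢i; punchIn-punchOut)
open import Data.Fin.Subset using (Subset; ∁; Nonempty)
open import Data.Fin.Subset.Properties using (nonempty?)
import Data.Integer as ℤ
open import Data.List
  using (List; []; _∷_; length; map; _++_; upTo; allFin; cartesianProductWith; filter; deduplicate)
open import Data.List.Properties
  using (length-map; length-++; length-tabulate; length-filter; length-deduplicate)
open import Data.List.Membership.Propositional using (_∈_; find; lose)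
open import Data.List.Membership.Propositional.Properties
  using (∈-upTo⁺; ∈-upTo⁻; ∈-allFin; ∈-cartesianProductWith⁺; ∈-cartesianProductWith⁻;
         ∈-filter⁺; ∈-filter⁻; ∈-deduplicate⁻)
import Data.List.Relation.Unary.All as All
open import Data.List.Relation.Unary.All.Properties using (all⁺)
open import Data.List.Relation.Unary.Any using (Any)
import Data.List.Relation.Unary.Any.Properties as Any
import Data.List.Relation.Unary.Unique.DecSetoid.Properties as UniqueDecSetoid
import Data.List.Relation.Unary.Unique.Propositional.Properties as UniquePropositional
import Data.List.Relation.Unary.Unique.Setoid.Properties as UniqueSetoid
open import Data.Nat
open import Data.Nat.Coprimality using (1-coprimeTo) renaming (sym to coprime-sym)
open import Data.Nat.Properties
open import Data.Product using (∃-syntax; _×_; _,_; proj₁; proj₂)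
open import Data.Rational using (ℚ; mkℚ)
open import Data.Rational.Properties using (nonNegative⁻¹) renaming (_<?_ to _<ℚ?_)
open import Data.Sum using (_⊎_; inj₁; inj₂; [_,_]′)
open import Data.Vec using ([]; _∷_; lookup)
open import Data.Vec.Properties using (lookup∘tabulate; lookup-map; lookup⇒[]=; ≡-dec)
open import Function using (_∘_; id)
open import Function.Bundles using (Equivalence)
open import Level using (0ℓ)
open import Relation.Binary.Bundles using (DecSetoid)
open import Relation.Binary.PropositionalEquality
  using (_≡_; _≢_; refl; sym; trans; cong; cong₂; subst; subst₂; module ≡-Reasoning)
open import Relation.Binary.PropositionalEquality.Properties using () renaming (setoid to ≡-setoid)
open import Relation.Nullary using (¬_; Dec; yes; no; does; contradiction)
open import Relation.Nullary.Decidable using (_×-dec_; _⊎-dec_)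

open Equivalence using (to; from)

∣-∣≤⇒≤+ : ∀ {m n o} → ∣ m - n ∣ ≤ o → m ≤ n + o × n ≤ m + o
∣-∣≤⇒≤+ {m} {n} mn≤o = ≤-trans (m≤n+∣m-n∣ m n) (+-monoʳ-≤ n mn≤o) ,
                        ≤-trans (m≤n+∣n-m∣ n m) (+-monoʳ-≤ m mn≤o)

≤+⇒∣-∣≤ : ∀ {m n o} → m ≤ n + o → n ≤ m + o → ∣ m - n ∣ ≤ o
≤+⇒∣-∣≤ {m} {n} {o} m≤n+o n≤m+o with ∣m-n∣≡[m∸n]∨[n∸m] m n
... | inj₁ eq = subst (_≤ o) (sym eq) (m≤n+o⇒m∸n≤o m n m≤n+o)
... | inj₂ eq = subst (_≤ o) (sym eq) (m≤n+o⇒m∸n≤o n m n≤m+o)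

m+o≤n⇒o≤∣m-n∣ : ∀ {m n o} → m + o ≤ n → o ≤ ∣ m - n ∣
m+o≤n⇒o≤∣m-n∣ {m} {n} {o} m+o≤n = +-cancelˡ-≤ m o ∣ m - n ∣ (≤-trans m+o≤n (m≤n+∣n-m∣ n m))

n+o≤m⇒o≤∣m-n∣ : ∀ {m n o} → n + o ≤ m → o ≤ ∣ m - n ∣
n+o≤m⇒o≤∣m-n∣ {m} {n} n+o≤m = subst (_ ≤_) (∣-∣-comm n m) (m+o≤n⇒o≤∣m-n∣ n+o≤m)

o≤∣m-n∣⇒o+m≤n : ∀ {m n o} → m ≤ n → o ≤ ∣ m - n ∣ → o + m ≤ n
o≤∣m-n∣⇒o+m≤n {m} {n} {o} m≤n o≤mn = begin
  o + m      ≤⟨ +-monoˡ-≤ m (subst (o ≤_) (m≤n⇒∣m-n∣≡n∸m m≤n) o≤mn) ⟩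
  n ∸ m + m  ≡⟨ m∸n+n≡m m≤n ⟩
  n          ∎
  where open ≤-Reasoning

m≢n⇒0<∣m-n∣ : ∀ {m n} → m ≢ n → 0 < ∣ m - n ∣
m≢n⇒0<∣m-n∣ m≢n = n≢0⇒n>0 (m≢n ∘ ∣m-n∣≡0⇒m≡n)

∣n-1+n∣≡1 : ∀ n → ∣ n - suc n ∣ ≡ 1
∣n-1+n∣≡1 zero = refl
∣n-1+n∣≡1 (suc n) = ∣n-1+n∣≡1 n

∣1+n-n∣≡1 : ∀ n → ∣ suc n - n ∣ ≡ 1
∣1+n-n∣≡1 n = trans (∣-∣-comm (suc n) n) (∣n-1+n∣≡1 n)

∣k+n-n∣≡k : ∀ k n → ∣ k + n - n ∣ ≡ k
∣k+n-n∣≡k k n = trans (cong ∣_- n ∣ (+-comm k n)) (trans (∣-∣-comm (n + k) n) (∣m-m+n∣≡n n k))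

reverse-triangle : ∀ u v x k d → k + d ≤ ∣ u - v ∣ → ∣ v - x ∣ ≤ d → k ≤ ∣ u - x ∣
reverse-triangle u v x k d k+d≤uv vx≤d = +-cancelʳ-≤ d k ∣ u - x ∣ (begin
  k + d                  ≤⟨ k+d≤uv ⟩
  ∣ u - v ∣              ≤⟨ ∣-∣-triangle u x v ⟩
  ∣ u - x ∣ + ∣ x - v ∣  ≡⟨ cong (∣ u - x ∣ +_) (∣-∣-comm x v) ⟩
  ∣ u - x ∣ + ∣ v - x ∣  ≤⟨ +-monoʳ-≤ ∣ u - x ∣ vx≤d ⟩
  ∣ u - x ∣ + d          ∎)
  where open ≤-Reasoning

midpoint-≤ : ∀ {a b} k → a ≤ b → b ≤ a + (k + k) → ∣ b ∸ k - a ∣ ≤ k × ∣ b ∸ k - b ∣ ≤ k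
midpoint-≤ {a} {b} k a≤b b≤a+2k =
  ≤+⇒∣-∣≤ (m≤n+o⇒m∸n≤o b k (subst (b ≤_) (trans (sym (+-assoc a k k)) (+-comm (a + k) k)) b≤a+2k))
          (≤-trans a≤b b≤b∸k+k) ,
  ≤+⇒∣-∣≤ (≤-trans (m∸n≤m b k) (m≤m+n b k)) b≤b∸k+k
  where
  b≤b∸k+k : b ≤ b ∸ k + k
  b≤b∸k+k = subst (b ≤_) (+-comm k (b ∸ k)) (m≤n+m∸n b k)

midpoint : ∀ {a b} k → ∣ a - b ∣ ≤ k + k → ∃[ c ] (c ≤ a ⊎ c ≤ b) × ∣ c - a ∣ ≤ k × ∣ c - b ∣ ≤ k
midpoint {a} {b} k ab≤2k with ≤-total a b
... | inj₁ a≤b = let ca , cb = midpoint-≤ k a≤b (proj₂ (∣-∣≤⇒≤+ {a} {b} ab≤2k)) in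
                 b ∸ k , inj₂ (m∸n≤m b k) , ca , cb
... | inj₂ b≤a = let cb , ca = midpoint-≤ k b≤a (proj₁ (∣-∣≤⇒≤+ {a} {b} ab≤2k)) in
                 a ∸ k , inj₁ (m∸n≤m a k) , ca , cb

window : ∀ {n} r p → r + r < n → p < n →
         ∃[ c ] c + suc (r + r) ≤ n ×
                (∀ {y} → y < n → ∣ p - y ∣ ≤ r → ∃[ a ] a < suc (r + r) × y ≡ c + a)
window {n} r p 2r<n p<n = c , window-fits , offset
  where
  open ≤-Reasoning
  c = (p ∸ r) ⊓ (n ∸ suc (r + r))
  window-fits : c + suc (r + r) ≤ n
  window-fits = begin
    c + suc (r + r)                ≤⟨ +-monoˡ-≤ (suc (r + r)) (m⊓n≤n (p ∸ r) _) ⟩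
    n ∸ suc (r + r) + suc (r + r)  ≡⟨ m∸n+n≡m 2r<n ⟩
    n                              ∎
  offset : ∀ {y} → y < n → ∣ p - y ∣ ≤ r → ∃[ a ] a < suc (r + r) × y ≡ c + a
  offset {y} y<n py≤r = y ∸ c , s≤s (m≤n+o⇒m∸n≤o y c y≤c+2r) , sym (m+[n∸m]≡n c≤y)
    where
    c≤y : c ≤ y
    c≤y = ≤-trans (m⊓n≤m (p ∸ r) _)
                  (m≤n+o⇒m∸n≤o p r (subst (p ≤_) (+-comm y r) (proj₁ (∣-∣≤⇒≤+ py≤r))))
    y≤c+2r : y ≤ c + (r + r)
    y≤c+2r with ≤-total (p ∸ r) (n ∸ suc (r + r))
    ... | inj₁ low rewrite m≤n⇒m⊓n≡m low = begin
      y                  ≤⟨ proj₂ (∣-∣≤⇒≤+ py≤r) ⟩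
      p + r              ≤⟨ +-monoˡ-≤ r (m≤n+m∸n p r) ⟩
      r + (p ∸ r) + r    ≡⟨ cong (_+ r) (+-comm r (p ∸ r)) ⟩
      p ∸ r + r + r      ≡⟨ +-assoc (p ∸ r) r r ⟩
      p ∸ r + (r + r)    ∎
    ... | inj₂ high rewrite m≥n⇒m⊓n≡n high =
      s≤s⁻¹ (subst (y <_) (trans (sym (m∸n+n≡m 2r<n)) (+-suc _ (r + r))) y<n)

-- The sets X_{u,v} of the profile distance

profile : ℕ → ℕ
profile 0 = 0
profile 1 = 4
profile 2 = 3
profile 3 = 2
profile (suc (suc (suc (suc _)))) = 1

-- closer u v x decides x ∈ X_{u,v} for the distance profile ∣ x - y ∣ (see lookup-Xuv).
closer : ℕ → ℕ → ℕ → Bool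
closer u v x = profile ∣ u - x ∣ <ᵇ profile ∣ v - x ∣

profile-suc-<ᵇ : ∀ a b → (profile (suc a) <ᵇ profile (suc b)) ≡ ((b <ᵇ 3) ∧ (b <ᵇ a))
profile-suc-<ᵇ 0 0 = refl
profile-suc-<ᵇ 0 1 = refl
profile-suc-<ᵇ 0 2 = refl
profile-suc-<ᵇ 0 (suc (suc (suc b))) = refl
profile-suc-<ᵇ 1 0 = refl
profile-suc-<ᵇ 1 1 = refl
profile-suc-<ᵇ 1 2 = refl
profile-suc-<ᵇ 1 (suc (suc (suc b))) = refl
profile-suc-<ᵇ 2 0 = refl
profile-suc-<ᵇ 2 1 = refl
profile-suc-<ᵇ 2 2 = refl
profile-suc-<ᵇ 2 (suc (suc (suc b))) = refl
profile-suc-<ᵇ (suc (suc (suc a))) 0 = refl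
profile-suc-<ᵇ (suc (suc (suc a))) 1 = refl
profile-suc-<ᵇ (suc (suc (suc a))) 2 = refl
profile-suc-<ᵇ (suc (suc (suc a))) (suc (suc (suc b))) = refl

profile-pos : ∀ b → 0 < profile (suc b)
profile-pos 0 = z<s
profile-pos 1 = z<s
profile-pos 2 = z<s
profile-pos (suc (suc (suc b))) = z<s

closer-source : ∀ u v → 0 < ∣ v - u ∣ → closer u v u ≡ true
closer-source u v 0<vu rewrite ∣n-n∣≡0 u with ∣ v - u ∣ | 0<vu
... | suc b | _ = T-≡ .to (<⇒<ᵇ (profile-pos b))

closer-target : ∀ u v → closer u v v ≡ false
closer-target u v rewrite ∣n-n∣≡0 v = refl

closer⇒ : ∀ u v x → 0 < ∣ u - x ∣ → closer u v x ≡ true →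
          0 < ∣ v - x ∣ × ∣ v - x ∣ ≤ 3 × ∣ v - x ∣ < ∣ u - x ∣
closer⇒ u v x = go ∣ u - x ∣ ∣ v - x ∣
  where
  go : ∀ a b → 0 < a → (profile a <ᵇ profile b) ≡ true → 0 < b × b ≤ 3 × b < a
  go (suc a) (suc b) _ pa<pb rewrite profile-suc-<ᵇ a b =
    let b<3 , b<a = T-∧ .to (T-≡ .from pa<pb) in z<s , <ᵇ⇒< b 3 b<3 , s<s (<ᵇ⇒< b a b<a)

closer⇐ : ∀ u v x → 0 < ∣ v - x ∣ → ∣ v - x ∣ ≤ 3 → ∣ v - x ∣ < ∣ u - x ∣ → closer u v x ≡ true
closer⇐ u v x = go ∣ u - x ∣ ∣ v - x ∣
  where
  go : ∀ a b → 0 < b → b ≤ 3 → b < a → (profile a <ᵇ profile b) ≡ true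
  go (suc a) (suc b) _ b<3 (s<s b<a) rewrite profile-suc-<ᵇ a b =
    T-≡ .to (T-∧ .from (<⇒<ᵇ b<3 , <⇒<ᵇ b<a))

closer-far : ∀ u v x → 0 < ∣ u - x ∣ → 3 < ∣ v - x ∣ → closer u v x ≡ false
closer-far u v x 0<ux 3<vx with closer u v x in x∈X
... | false = refl
... | true = contradiction (proj₁ (proj₂ (closer⇒ u v x 0<ux x∈X))) (<⇒≱ 3<vx)

closer-neighbour : ∀ u v x → ∣ v - x ∣ ≡ 1 → 3 ≤ ∣ u - v ∣ → 0 < ∣ u - x ∣ × closer u v x ≡ true
closer-neighbour u v x vx≡1 3≤uv =
  <-trans z<s 1<ux ,
  closer⇐ u v x (subst (0 <_) (sym vx≡1) z<s) (subst (_≤ 3) (sym vx≡1) (s≤s z≤n))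
                (subst (_< ∣ u - x ∣) (sym vx≡1) 1<ux)
  where
  1<ux : 1 < ∣ u - x ∣
  1<ux = reverse-triangle u v x 2 1 3≤uv (≤-reflexive vx≡1)

closer-distant-source : ∀ u v x → 7 ≤ ∣ u - v ∣ → 0 < ∣ v - x ∣ → ∣ v - x ∣ ≤ 3 →
                        0 < ∣ u - x ∣ × closer u v x ≡ true
closer-distant-source u v x 7≤uv 0<vx vx≤3 =
  <-trans z<s 3<ux , closer⇐ u v x 0<vx vx≤3 (≤-<-trans vx≤3 3<ux)
  where
  3<ux : 3 < ∣ u - x ∣
  3<ux = reverse-triangle u v x 4 3 7≤uv vx≤3

closer-translate : ∀ c u v x → closer (c + u) (c + v) (c + x) ≡ closer u v x
closer-translate c u v x rewrite ∣m+n-m+o∣≡∣n-o∣ c u x | ∣m+n-m+o∣≡∣n-o∣ c v x = refl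

AgreeBelow : ℕ → (ℕ → Bool) → (ℕ → Bool) → Set
AgreeBelow n f g = ∀ x → x < n → f x ≡ g x

-- Pairs inside 13 consecutive points

AgreeBelow-translate : ∀ {n m} c {a b a′ b′} → c + m ≤ n →
  AgreeBelow n (closer (c + a) (c + b)) (closer (c + a′) (c + b′)) →
  AgreeBelow m (closer a b) (closer a′ b′)
AgreeBelow-translate c {a} {b} {a′} {b′} c+m≤n agree x x<m = begin
  closer a b x                      ≡⟨ closer-translate c a b x ⟨
  closer (c + a) (c + b) (c + x)    ≡⟨ agree (c + x) (<-≤-trans (+-monoʳ-< c x<m) c+m≤n) ⟩
  closer (c + a′) (c + b′) (c + x)  ≡⟨ closer-translate c a′ b′ x ⟩
  closer a′ b′ x                    ∎
  where open ≡-Reasoning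

all-upTo : ∀ {m} (p : ℕ → Bool) → T (all p (upTo m)) → ∀ {x} → x < m → T (p x)
all-upTo p all-p x<m = All.lookup (all⁺ p _ all-p) (∈-upTo⁺ x<m)

separatedBelow : ℕ → ℕ → ℕ → ℕ → ℕ → Bool
separatedBelow m a b a′ b′ = any (λ x → closer a b x xor closer a′ b′ x) (upTo m)

separatedBelow-sound : ∀ {m a b a′ b′} → T (separatedBelow m a b a′ b′) →
                       ¬ AgreeBelow m (closer a b) (closer a′ b′)
separatedBelow-sound {m} {a′ = a′} {b′ = b′} separated agree
  with x , x∈ , differ ← find (Any.any⁻ _ (upTo m) separated)
  rewrite agree x (∈-upTo⁻ x∈) | xor-same (closer a′ b′ x) = differ

pairsSeparatedBelow : ℕ → Bool
pairsSeparatedBelow m =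
  all (λ a → all (λ b → all (λ a′ → all (λ b′ →
    (a ≡ᵇ b) ∨ (a′ ≡ᵇ b′) ∨ ((a ≡ᵇ a′) ∧ (b ≡ᵇ b′)) ∨ separatedBelow m a b a′ b′)
  (upTo m)) (upTo m)) (upTo m)) (upTo m)

pairsSeparatedBelow-sound : ∀ {m a b a′ b′} → pairsSeparatedBelow m ≡ true →
  a < m → b < m → a′ < m → b′ < m → a ≢ b → a′ ≢ b′ →
  AgreeBelow m (closer a b) (closer a′ b′) → a ≡ a′ × b ≡ b′
pairsSeparatedBelow-sound {m} {a} {b} {a′} {b′} checked a<m b<m a′<m b′<m a≢b a′≢b′ agree
  with T-∨ .to (all-upTo _ (all-upTo _ (all-upTo _ (all-upTo _ (T-≡ .from checked) a<m) b<m) a′<m) b′<m)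
... | inj₁ a≡b = contradiction (≡ᵇ⇒≡ a b a≡b) a≢b
... | inj₂ rest with T-∨ .to rest
...   | inj₁ a′≡b′ = contradiction (≡ᵇ⇒≡ a′ b′ a′≡b′) a′≢b′
...   | inj₂ rest′ with T-∨ .to rest′
...     | inj₁ same = let a≡a′ , b≡b′ = T-∧ .to same in ≡ᵇ⇒≡ a a′ a≡a′ , ≡ᵇ⇒≡ b b′ b≡b′
...     | inj₂ separated = contradiction agree (separatedBelow-sound {m} {a} {b} {a′} {b′} separated)

pairsSeparatedBelow-13 : pairsSeparatedBelow 13 ≡ true
pairsSeparatedBelow-13 = refl

Within₆ : ℕ → ℕ → ℕ → Set
Within₆ n p y = y < n × ∣ p - y ∣ ≤ 6

near-injective : ∀ {n} p u v u′ v′ → 13 ≤ n → p < n →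
                 Within₆ n p u → Within₆ n p v → Within₆ n p u′ → Within₆ n p v′ → u ≢ v → u′ ≢ v′ →
                 AgreeBelow n (closer u v) (closer u′ v′) → u ≡ u′ × v ≡ v′
near-injective {n} p u v u′ v′ 13≤n p<n
               (u<n , pu≤6) (v<n , pv≤6) (u′<n , pu′≤6) (v′<n , pv′≤6) u≢v u′≢v′ agree =
  let c , fits , offset = window 6 p 13≤n p<n
      a , a<13 , u≡c+a = offset u<n pu≤6
      b , b<13 , v≡c+b = offset v<n pv≤6
      a′ , a′<13 , u′≡c+a′ = offset u′<n pu′≤6
      b′ , b′<13 , v′≡c+b′ = offset v′<n pv′≤6
      shifted : ∀ {x y k l} → x ≡ c + k → y ≡ c + l → k ≡ l → x ≡ y
      shifted x≡c+k y≡c+l k≡l = trans x≡c+k (trans (cong (c +_) k≡l) (sym y≡c+l))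
      agree-shifted : AgreeBelow n (closer (c + a) (c + b)) (closer (c + a′) (c + b′))
      agree-shifted x x<n = begin
        closer (c + a) (c + b) x    ≡⟨ cong₂ (λ s t → closer s t x) u≡c+a v≡c+b ⟨
        closer u v x                ≡⟨ agree x x<n ⟩
        closer u′ v′ x              ≡⟨ cong₂ (λ s t → closer s t x) u′≡c+a′ v′≡c+b′ ⟩
        closer (c + a′) (c + b′) x  ∎
      a≡a′ , b≡b′ = pairsSeparatedBelow-sound {13} {a} {b} {a′} {b′} pairsSeparatedBelow-13
                      a<13 b<13 a′<13 b′<13 (u≢v ∘ shifted u≡c+a v≡c+b) (u′≢v′ ∘ shifted u′≡c+a′ v′≡c+b′)
                      (AgreeBelow-translate c {a} {b} {a′} {b′} fits agree-shifted)
  in shifted u≡c+a u′≡c+a′ a≡a′ , shifted v≡c+b v′≡c+b′ b≡b′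
  where open ≡-Reasoning

-- Pairs with distinct sources

other-source-near : ∀ {n} u v u′ v′ → u′ < n → u ≢ u′ → u′ ≢ v′ →
                    AgreeBelow n (closer u v) (closer u′ v′) → ∣ v - u′ ∣ ≤ 3
other-source-near u v u′ v′ u′<n u≢u′ u′≢v′ agree =
  proj₁ (proj₂ (closer⇒ u v u′ (m≢n⇒0<∣m-n∣ u≢u′)
                         (trans (agree u′ u′<n) (closer-source u′ v′ (m≢n⇒0<∣m-n∣ (u′≢v′ ∘ sym))))))

CloserSet⊆Pair : ℕ → ℕ → ℕ → ℕ → Set
CloserSet⊆Pair n u v w = ∀ x → x < n → closer u v x ≡ true → x ≡ u ⊎ x ≡ w

agree⇒closerSet⊆Pair : ∀ {n} u v u′ v′ → 7 ≤ ∣ v - v′ ∣ →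
  AgreeBelow n (closer u v) (closer u′ v′) → CloserSet⊆Pair n u v u′
agree⇒closerSet⊆Pair u v u′ v′ 7≤vv′ agree x x<n x∈X with x ≟ u | x ≟ u′
... | yes x≡u | _ = inj₁ x≡u
... | no _ | yes x≡u′ = inj₂ x≡u′
... | no x≢u | no x≢u′ = contradiction (begin
  ∣ v - v′ ∣             ≤⟨ ∣-∣-triangle v x v′ ⟩
  ∣ v - x ∣ + ∣ x - v′ ∣ ≡⟨ cong (∣ v - x ∣ +_) (∣-∣-comm x v′) ⟩
  ∣ v - x ∣ + ∣ v′ - x ∣ ≤⟨ +-mono-≤ (near u v x≢u x∈X)
                                     (near u′ v′ x≢u′ (trans (sym (agree x x<n)) x∈X)) ⟩
  6                      ∎) (<⇒≱ 7≤vv′)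
  where
  open ≤-Reasoning
  near : ∀ a b → x ≢ a → closer a b x ≡ true → ∣ b - x ∣ ≤ 3
  near a b x≢a x∈X = proj₁ (proj₂ (closer⇒ a b x (m≢n⇒0<∣m-n∣ (x≢a ∘ sym)) x∈X))

closerSet⊆Pair⇒boundary : ∀ {n} u v w → v < n → 3 ≤ ∣ u - v ∣ → CloserSet⊆Pair n u v w →
                          v ≡ 0 ⊎ suc v ≡ n
closerSet⊆Pair⇒boundary u zero w _ _ _ = inj₁ refl
closerSet⊆Pair⇒boundary {n} u (suc p) w v<n 3≤uv ⊆pair with suc (suc p) <? n
... | no v+1≮n = inj₂ (≤∧≮⇒≡ v<n v+1≮n)
... | yes v+1<n = contradiction (trans (neighbour≡w p (<-trans (n<1+n p) v<n) (∣1+n-n∣≡1 p))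
                                     (sym (neighbour≡w (suc (suc p)) v+1<n (∣n-1+n∣≡1 p))))
                              (<⇒≢ (m<n⇒m<1+n (n<1+n p)))
  where
  neighbour≡w : ∀ x → x < n → ∣ suc p - x ∣ ≡ 1 → x ≡ w
  neighbour≡w x x<n vx≡1 with closer-neighbour u (suc p) x vx≡1 3≤uv
  ... | 0<ux , x∈X with ⊆pair x x<n x∈X
  ...   | inj₁ x≡u = contradiction (trans (cong (∣ u -_∣) x≡u) (∣n-n∣≡0 u)) (>⇒≢ 0<ux)
  ...   | inj₂ x≡w = x≡w

closerSet⊆Pair-edge : ∀ {n u w} → 2 < n → 5 ≤ u → ¬ CloserSet⊆Pair n u 0 w
closerSet⊆Pair-edge {u = u} 2<n (s≤s (s≤s (s≤s (s≤s (s≤s _))))) ⊆pair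
  with ⊆pair 1 (<-trans (s≤s (s≤s z≤n)) 2<n) refl
     | ⊆pair 2 2<n (closer⇐ u 0 2 z<s (s≤s (s≤s z≤n)) (s≤s (s≤s (s≤s z≤n))))
... | inj₁ () | _
... | _ | inj₁ ()
... | inj₂ 1≡w | inj₂ 2≡w with trans 1≡w (sym 2≡w)
...   | ()

distinct-sources-far : ∀ {n u v u′ v′} → 9 ≤ n → v < n → v′ < n →
  ∣ v - u′ ∣ ≤ 3 → ∣ v′ - u ∣ ≤ 3 → 7 ≤ ∣ v - v′ ∣ → ¬ AgreeBelow n (closer u v) (closer u′ v′)
distinct-sources-far {n} {u} {v} {u′} {v′} 9≤n v<n v′<n vu′≤3 v′u≤3 7≤vv′ agree =
  ends (closerSet⊆Pair⇒boundary u v u′ v<n (source-far u v v′ v′u≤3 7≤vv′) ⊆pair)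
       (closerSet⊆Pair⇒boundary u′ v′ u v′<n (source-far u′ v′ v vu′≤3 7≤v′v) ⊆pair′)
  where
  7≤v′v = subst (7 ≤_) (∣-∣-comm v v′) 7≤vv′
  ⊆pair = agree⇒closerSet⊆Pair u v u′ v′ 7≤vv′ agree
  ⊆pair′ = agree⇒closerSet⊆Pair u′ v′ u v 7≤v′v (λ x x<n → sym (agree x x<n))
  source-far : ∀ a b b′ → ∣ b′ - a ∣ ≤ 3 → 7 ≤ ∣ b - b′ ∣ → 3 ≤ ∣ a - b ∣
  source-far a b b′ b′a≤3 7≤bb′ =
    subst (3 ≤_) (∣-∣-comm b a) (≤-trans (n≤1+n 3) (reverse-triangle b b′ a 4 3 7≤bb′ b′a≤3))
  5≤source : ∀ {a b′} → suc b′ ≡ n → ∣ b′ - a ∣ ≤ 3 → 5 ≤ a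
  5≤source {a} {b′} 1+b′≡n b′a≤3 =
    +-cancelʳ-≤ 3 5 a (≤-trans (s≤s⁻¹ (subst (9 ≤_) (sym 1+b′≡n) 9≤n)) (proj₁ (∣-∣≤⇒≤+ {b′} {a} b′a≤3)))
  2<n : 2 < n
  2<n = ≤-trans (s≤s (s≤s (s≤s z≤n))) 9≤n
  ends : v ≡ 0 ⊎ suc v ≡ n → v′ ≡ 0 ⊎ suc v′ ≡ n → ⊥
  ends (inj₁ v≡0) (inj₁ v′≡0) = contradiction (subst₂ (λ a b → 7 ≤ ∣ a - b ∣) v≡0 v′≡0 7≤vv′) λ ()
  ends (inj₂ v+1≡n) (inj₂ v′+1≡n) =
    contradiction (subst (λ a → 7 ≤ ∣ v - a ∣) (suc-injective (trans v′+1≡n (sym v+1≡n))) 7≤vv′)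
                  (subst (λ d → ¬ 7 ≤ d) (sym (∣n-n∣≡0 v)) λ ())
  ends (inj₁ v≡0) (inj₂ v′+1≡n) =
    closerSet⊆Pair-edge 2<n (5≤source v′+1≡n v′u≤3) (subst (λ b → CloserSet⊆Pair n u b u′) v≡0 ⊆pair)
  ends (inj₂ v+1≡n) (inj₁ v′≡0) =
    closerSet⊆Pair-edge 2<n (5≤source v+1≡n vu′≤3) (subst (λ b → CloserSet⊆Pair n u′ b u) v′≡0 ⊆pair′)

distinct-sources-near : ∀ {n} u v u′ v′ → 13 ≤ n → u < n → v < n → u′ < n → v′ < n →
  u ≢ v → u′ ≢ v′ → u ≢ u′ → ∣ v - u′ ∣ ≤ 3 → ∣ v′ - u ∣ ≤ 3 → ∣ v - v′ ∣ ≤ 6 →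
  ¬ AgreeBelow n (closer u v) (closer u′ v′)
distinct-sources-near u v u′ v′ 13≤n u<n v<n u′<n v′<n u≢v u′≢v′ u≢u′ vu′≤3 v′u≤3 vv′≤6 agree =
  let c , c≤v⊎v′ , cv≤3 , cv′≤3 = midpoint {v} {v′} 3 vv′≤6
      c<n = [ (λ c≤v → ≤-<-trans c≤v v<n) , (λ c≤v′ → ≤-<-trans c≤v′ v′<n) ]′ c≤v⊎v′
      via : ∀ w y → ∣ c - w ∣ ≤ 3 → ∣ w - y ∣ ≤ 3 → ∣ c - y ∣ ≤ 6
      via w y cw≤3 wy≤3 = ≤-trans (∣-∣-triangle c w y) (+-mono-≤ cw≤3 wy≤3)
  in u≢u′ (proj₁ (near-injective c u v u′ v′ 13≤n c<n
        (u<n , via v′ u cv′≤3 v′u≤3) (v<n , ≤-trans cv≤3 (m≤m+n 3 3))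
        (u′<n , via v u′ cv≤3 vu′≤3) (v′<n , ≤-trans cv′≤3 (m≤m+n 3 3)) u≢v u′≢v′ agree))

distinct-sources-disagree : ∀ {n} u v u′ v′ → 13 ≤ n → u < n → v < n → u′ < n → v′ < n →
  u ≢ v → u′ ≢ v′ → u ≢ u′ → ¬ AgreeBelow n (closer u v) (closer u′ v′)
distinct-sources-disagree u v u′ v′ 13≤n u<n v<n u′<n v′<n u≢v u′≢v′ u≢u′ agree =
  by-distance (∣ v - v′ ∣ ≤? 6)
  where
  vu′≤3 = other-source-near u v u′ v′ u′<n u≢u′ u′≢v′ agree
  v′u≤3 = other-source-near u′ v′ u v u<n (u≢u′ ∘ sym) u≢v (λ x x<n → sym (agree x x<n))
  by-distance : Dec (∣ v - v′ ∣ ≤ 6) → ⊥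
  by-distance (yes vv′≤6) =
    distinct-sources-near u v u′ v′ 13≤n u<n v<n u′<n v′<n u≢v u′≢v′ u≢u′ vu′≤3 v′u≤3 vv′≤6 agree
  by-distance (no vv′≰6) =
    distinct-sources-far (≤-trans (m≤m+n 9 4) 13≤n) v<n v′<n vu′≤3 v′u≤3 (≰⇒> vv′≰6) agree

-- Pairs with a common source

PuncturedBall⊆ : ℕ → ℕ → ℕ → Set
PuncturedBall⊆ n c c′ = ∀ x → x < n → 0 < ∣ c - x ∣ → ∣ c - x ∣ ≤ 3 → 0 < ∣ c′ - x ∣ × ∣ c′ - x ∣ ≤ 3

FarSideNeighbour : ℕ → ℕ → ℕ → Set
FarSideNeighbour n v v′ = ∃[ t ] t < n × ∣ v′ - v ∣ ≡ 4 × ∣ v - t ∣ ≡ 1 × ∣ v′ - t ∣ ≡ 5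

ball-neighbour : ∀ {n} c c′ x → PuncturedBall⊆ n c c′ → x < n → ∣ c - x ∣ ≡ 1 → ∣ c′ - x ∣ ≤ 3
ball-neighbour c c′ x ball x<n cx≡1 =
  proj₂ (ball x x<n (subst (0 <_) (sym cx≡1) z<s) (subst (_≤ 3) (sym cx≡1) (s≤s z≤n)))

puncturedBall⊆-below : ∀ {n} v v′ → 6 ≤ n → v < n → 4 + v′ ≤ v → PuncturedBall⊆ n v′ v →
                       FarSideNeighbour n v v′
puncturedBall⊆-below v zero 6≤n _ 4≤v ball
  with v≤4 ← proj₁ (∣-∣≤⇒≤+ {v} {1} (ball-neighbour 0 v 1 ball (≤-trans (s≤s (s≤s z≤n)) 6≤n) refl))
  rewrite ≤-antisym v≤4 4≤v = 5 , 6≤n , refl , refl , refl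
puncturedBall⊆-below v (suc q) 6≤n v<n 5+q≤v ball =
  contradiction (ball-neighbour (suc q) v q ball (<-trans (≤-<-trans (m≤n+m q 4) 5+q≤v) v<n)
                                (∣1+n-n∣≡1 q))
                (<⇒≱ (≤-trans (n≤1+n 4) (n+o≤m⇒o≤∣m-n∣ {v} {q} {5} (subst (_≤ v) (+-comm 5 q) 5+q≤v))))

puncturedBall⊆-top : ∀ {n} v w → 6 ≤ n → 5 + w ≡ n → v ≤ w → PuncturedBall⊆ n (4 + w) v →
                     FarSideNeighbour n v (4 + w)
puncturedBall⊆-top v zero (s≤s (s≤s (s≤s (s≤s (s≤s ()))))) refl _ _
puncturedBall⊆-top v (suc t) 6≤n refl v≤w ball
  with w≤v+3 ← proj₂ (∣-∣≤⇒≤+ {v} {3 + suc t}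
                 (ball-neighbour (4 + suc t) v (3 + suc t) ball (n≤1+n _) (∣1+n-n∣≡1 t)))
  rewrite ≤-antisym v≤w (+-cancelʳ-≤ 3 (suc t) v (subst (_≤ v + 3) (+-comm 3 (suc t)) w≤v+3)) =
  t , s≤s (m≤n+m t 5) , ∣k+n-n∣≡k 4 t , ∣1+n-n∣≡1 t , ∣k+n-n∣≡k 5 t

puncturedBall⊆-above : ∀ {n} v v′ → 6 ≤ n → v′ < n → 4 + v ≤ v′ → PuncturedBall⊆ n v′ v →
                       FarSideNeighbour n v v′
puncturedBall⊆-above {n} v v′@(suc (suc (suc (suc w)))) 6≤n v′<n 4+v≤v′@(s≤s (s≤s (s≤s (s≤s v≤w)))) ball
  with suc v′ <? n
... | yes 1+v′<n =
  contradiction (ball-neighbour v′ v (suc v′) ball 1+v′<n (∣n-1+n∣≡1 v′))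
                (<⇒≱ (≤-trans (n≤1+n 4) (m+o≤n⇒o≤∣m-n∣ {v} {suc v′} {5} v+5≤1+v′)))
  where v+5≤1+v′ = subst (_≤ suc v′) (+-comm 5 v) (s≤s 4+v≤v′)
... | no 1+v′≮n = puncturedBall⊆-top v w 6≤n (≤∧≮⇒≡ v′<n 1+v′≮n) v≤w ball

puncturedBall⊆⇒farSideNeighbour : ∀ {n} v v′ → 6 ≤ n → v < n → v′ < n → 4 ≤ ∣ v′ - v ∣ →
                                  PuncturedBall⊆ n v′ v → FarSideNeighbour n v v′
puncturedBall⊆⇒farSideNeighbour v v′ 6≤n v<n v′<n 4≤v′v ball with ≤-total v′ v
... | inj₁ v′≤v = puncturedBall⊆-below v v′ 6≤n v<n (o≤∣m-n∣⇒o+m≤n v′≤v 4≤v′v) ball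
... | inj₂ v≤v′ =
  puncturedBall⊆-above v v′ 6≤n v′<n (o≤∣m-n∣⇒o+m≤n v≤v′ (subst (4 ≤_) (∣-∣-comm v′ v) 4≤v′v)) ball

farSideNeighbour-separates : ∀ u v v′ t → 7 ≤ ∣ u - v′ ∣ →
                             ∣ v′ - v ∣ ≡ 4 → ∣ v - t ∣ ≡ 1 → ∣ v′ - t ∣ ≡ 5 →
                             closer u v t ≡ true × closer u v′ t ≡ false
farSideNeighbour-separates u v v′ t 7≤uv′ v′v≡4 vt≡1 v′t≡5 =
  proj₂ (closer-neighbour u v t vt≡1 (reverse-triangle u v′ v 3 4 7≤uv′ (≤-reflexive v′v≡4))) ,
  closer-far u v′ t (reverse-triangle u v′ t 1 5 (≤-trans (n≤1+n 6) 7≤uv′) (≤-reflexive v′t≡5))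
                    (subst (3 <_) (sym v′t≡5) (s≤s (s≤s (s≤s (s≤s z≤n)))))

agree⇒puncturedBall⊆ : ∀ {n} u v v′ → 7 ≤ ∣ u - v′ ∣ →
                       AgreeBelow n (closer u v) (closer u v′) → PuncturedBall⊆ n v′ v
agree⇒puncturedBall⊆ u v v′ 7≤uv′ agree x x<n 0<v′x v′x≤3 =
  let 0<ux , x∈X′ = closer-distant-source u v′ x 7≤uv′ 0<v′x v′x≤3
      0<vx , vx≤3 , _ = closer⇒ u v x 0<ux (trans (agree x x<n) x∈X′)
  in 0<vx , vx≤3

same-source-far : ∀ {n} u v v′ → 6 ≤ n → v < n → v′ < n → 7 ≤ ∣ u - v′ ∣ →
                  AgreeBelow n (closer u v) (closer u v′) → v ≡ v′
same-source-far u v v′ 6≤n v<n v′<n 7≤uv′ agree with v ≟ v′ | ∣ v′ - v ∣ ≤? 3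
... | yes v≡v′ | _ = v≡v′
... | no v≢v′ | yes v′v≤3 =
  contradiction (proj₁ (ball v v<n (m≢n⇒0<∣m-n∣ (v≢v′ ∘ sym)) v′v≤3))
                (subst (¬_ ∘ (0 <_)) (sym (∣n-n∣≡0 v)) λ ())
  where ball = agree⇒puncturedBall⊆ u v v′ 7≤uv′ agree
... | no _ | no v′v≰3 =
  let t , t<n , v′v≡4 , vt≡1 , v′t≡5 = puncturedBall⊆⇒farSideNeighbour v v′ 6≤n v<n v′<n (≰⇒> v′v≰3)
                                          (agree⇒puncturedBall⊆ u v v′ 7≤uv′ agree)
      t∈X , t∉X′ = farSideNeighbour-separates u v v′ t 7≤uv′ v′v≡4 vt≡1 v′t≡5
  in contradiction (trans (sym t∈X) (trans (agree t t<n) t∉X′)) λ ()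

same-source-agree⇒≡ : ∀ {n} u v v′ → 13 ≤ n → u < n → v < n → v′ < n → u ≢ v → u ≢ v′ →
                      AgreeBelow n (closer u v) (closer u v′) → v ≡ v′
same-source-agree⇒≡ u v v′ 13≤n u<n v<n v′<n u≢v u≢v′ agree =
  by-distance (∣ u - v ∣ ≤? 6) (∣ u - v′ ∣ ≤? 6)
  where
  6≤n = ≤-trans (m≤m+n 6 7) 13≤n
  uu≤6 = subst (_≤ 6) (sym (∣n-n∣≡0 u)) z≤n
  by-distance : Dec (∣ u - v ∣ ≤ 6) → Dec (∣ u - v′ ∣ ≤ 6) → v ≡ v′
  by-distance (yes uv≤6) (yes uv′≤6) =
    proj₂ (near-injective u u v u v′ 13≤n u<n (u<n , uu≤6) (v<n , uv≤6) (u<n , uu≤6) (v′<n , uv′≤6)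
                          u≢v u≢v′ agree)
  by-distance _ (no uv′≰6) = same-source-far u v v′ 6≤n v<n v′<n (≰⇒> uv′≰6) agree
  by-distance (no uv≰6) _ =
    sym (same-source-far u v′ v 6≤n v′<n v<n (≰⇒> uv≰6) (λ x x<n → sym (agree x x<n)))

closer-injective : ∀ {n} u v u′ v′ → 13 ≤ n → u < n → v < n → u′ < n → v′ < n → u ≢ v → u′ ≢ v′ →
                   AgreeBelow n (closer u v) (closer u′ v′) → u ≡ u′ × v ≡ v′
closer-injective u v u′ v′ 13≤n u<n v<n u′<n v′<n u≢v u′≢v′ agree with u ≟ u′
... | no u≢u′ =
  contradiction agree (distinct-sources-disagree u v u′ v′ 13≤n u<n v<n u′<n v′<n u≢v u′≢v′ u≢u′)
... | yes refl = refl , same-source-agree⇒≡ u v v′ 13≤n u<n v<n v′<n u≢v u′≢v′ agree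

-- Complements

FarFromWindow : ℕ → ℕ → Set
FarFromWindow s v = v + 4 ≤ s ⊎ 6 + s ≤ v

farFromWindow⇒far : ∀ {s v} → FarFromWindow s v → ∀ x → s ≤ x → x ≤ 2 + s → 3 < ∣ v - x ∣
farFromWindow⇒far {s} {v} (inj₁ v+4≤s) x s≤x _ = m+o≤n⇒o≤∣m-n∣ {v} {x} {4} (≤-trans v+4≤s s≤x)
farFromWindow⇒far {s} {v} (inj₂ 6+s≤v) x _ x≤2+s =
  n+o≤m⇒o≤∣m-n∣ {v} {x} {4} (≤-trans (+-monoˡ-≤ 4 x≤2+s) (subst (_≤ v) (+-comm 4 (2 + s)) 6+s≤v))

farWindow-low : ∀ {v} → v < 6 → ∀ v′ → ∃[ s ] s ≤ 20 × FarFromWindow s v × FarFromWindow s v′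
farWindow-low {v} v<6 v′ with v′ ≤? 16
... | yes v′≤16 = 20 , ≤-refl , inj₁ (≤-trans v+4≤10 (m≤m+n 10 10)) , inj₁ (+-monoˡ-≤ 4 v′≤16)
  where v+4≤10 = +-monoˡ-≤ 4 (<⇒≤ v<6)
... | no v′≰16 = 10 , m≤m+n 10 10 , inj₁ (+-monoˡ-≤ 4 (<⇒≤ v<6)) , inj₂ (<⇒≤ (≰⇒> v′≰16))

farWindow : ∀ v v′ → ∃[ s ] s ≤ 20 × FarFromWindow s v × FarFromWindow s v′
farWindow v v′ with 6 ≤? v | 6 ≤? v′
... | yes 6≤v | yes 6≤v′ = 0 , z≤n , inj₂ 6≤v , inj₂ 6≤v′
... | no 6≰v | _ = farWindow-low (≰⇒> 6≰v) v′
... | yes _ | no 6≰v′ =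
  let s , s≤20 , far′ , far = farWindow-low (≰⇒> 6≰v′) v in s , s≤20 , far , far′

avoid-one-more : ∀ s w → ∃[ x ] s ≤ x × x ≤ 2 + s × x ≢ s × x ≢ w
avoid-one-more s w with suc s ≟ w
... | no 1+s≢w = suc s , n≤1+n s , n≤1+n (suc s) , 1+n≢n , 1+s≢w
... | yes 1+s≡w = 2 + s , m≤n+m s 2 , ≤-refl , <⇒≢ (m<n⇒m<1+n (n<1+n s)) ∘ sym ,
                  λ 2+s≡w → 1+n≢n (trans 2+s≡w (sym 1+s≡w))

avoid-two : ∀ s u u′ → ∃[ x ] s ≤ x × x ≤ 2 + s × x ≢ u × x ≢ u′
avoid-two s u u′ with s ≟ u | s ≟ u′
... | no s≢u | no s≢u′ = s , ≤-refl , m≤n+m s 2 , s≢u , s≢u′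
... | yes s≡u | _ = let x , s≤x , x≤2+s , x≢s , x≢u′ = avoid-one-more s u′
                    in x , s≤x , x≤2+s , subst (_ ≢_) s≡u x≢s , x≢u′
... | no _ | yes s≡u′ = let x , s≤x , x≤2+s , x≢s , x≢u = avoid-one-more s u
                        in x , s≤x , x≤2+s , x≢u , subst (_ ≢_) s≡u′ x≢s

not-complementary : ∀ {n} u v u′ v′ → 23 ≤ n → ¬ AgreeBelow n (closer u v) (not ∘ closer u′ v′)
not-complementary u v u′ v′ 23≤n agree =
  let s , s≤20 , far , far′ = farWindow v v′
      x , s≤x , x≤2+s , x≢u , x≢u′ = avoid-two s u u′
      x<n = ≤-<-trans x≤2+s (≤-trans (s≤s (s≤s (s≤s s≤20))) 23≤n)
      x∉X = closer-far u v x (m≢n⇒0<∣m-n∣ (x≢u ∘ sym)) (farFromWindow⇒far far x s≤x x≤2+s)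
      x∉X′ = closer-far u′ v′ x (m≢n⇒0<∣m-n∣ (x≢u′ ∘ sym)) (farFromWindow⇒far far′ x s≤x x≤2+s)
  in contradiction (trans (sym x∉X) (trans (agree x x<n) (cong not x∉X′))) λ ()

-- The second argument of mkℚ is the denominator minus one.
fromℕ : ℕ → ℚ
fromℕ k = mkℚ (ℤ.+ k) 0 (coprime-sym (1-coprimeTo k))

fromℕ-<ᵇ : ∀ a b → does (fromℕ a <ℚ? fromℕ b) ≡ (a <ᵇ b)
fromℕ-<ᵇ a b rewrite *-identityʳ a | *-identityʳ b with a | b
... | zero  | zero  = refl
... | zero  | suc _ = refl
... | suc _ | zero  = refl
... | suc _ | suc _ = refl

midpathDistance : ∀ {n} → Fin n → Fin n → ℚ
midpathDistance x y = fromℕ (profile ∣ toℕ x - toℕ y ∣)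

midpathDistance-isDistance : ∀ {n} → IsDistance (midpathDistance {n})
midpathDistance-isDistance = record
  { symmetric = λ x y → cong (fromℕ ∘ profile) (∣-∣-comm (toℕ x) (toℕ y))
  ; zero-diag = λ x → cong (fromℕ ∘ profile) (∣n-n∣≡0 (toℕ x))
  ; nonneg    = λ x y → nonNegative⁻¹ (midpathDistance x y)
  }

lookup-Xuv : ∀ {n} (u v x : Fin n) → lookup (Xuv midpathDistance u v) x ≡ closer (toℕ u) (toℕ v) (toℕ x)
lookup-Xuv u v x =
  trans (lookup∘tabulate _ x) (fromℕ-<ᵇ (profile ∣ toℕ u - toℕ x ∣) (profile ∣ toℕ v - toℕ x ∣))

lookup-∁Xuv : ∀ {n} (u v x : Fin n) →
              lookup (∁ (Xuv midpathDistance u v)) x ≡ not (closer (toℕ u) (toℕ v) (toℕ x))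
lookup-∁Xuv u v x = trans (lookup-map x not (Xuv midpathDistance u v)) (cong not (lookup-Xuv u v x))

≡⇒agreeBelow : ∀ {n} {A B : Subset n} (f g : ℕ → Bool) →
               (∀ x → lookup A x ≡ f (toℕ x)) → (∀ x → lookup B x ≡ g (toℕ x)) →
               A ≡ B → AgreeBelow n f g
≡⇒agreeBelow {A = A} {B} f g A≗f B≗g A≡B x x<n = begin
  f x                    ≡⟨ cong f (toℕ-fromℕ< x<n) ⟨
  f (toℕ i)              ≡⟨ A≗f i ⟨
  lookup A i             ≡⟨ cong (λ S → lookup S i) A≡B ⟩
  lookup B i             ≡⟨ B≗g i ⟩
  g (toℕ i)              ≡⟨ cong g (toℕ-fromℕ< x<n) ⟩
  g x                    ∎
  where
  open ≡-Reasoning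
  i = fromℕ< x<n

Xuv-injective : ∀ {n} → 23 ≤ n → (u v u′ v′ : Fin n) → u ≢ v → u′ ≢ v′ →
                SameSplit (Xuv midpathDistance u v) (Xuv midpathDistance u′ v′) → u ≡ u′ × v ≡ v′
Xuv-injective 23≤n u v u′ v′ u≢v u′≢v′ (inj₁ X≡X′) =
  let u≡u′ , v≡v′ = closer-injective (toℕ u) (toℕ v) (toℕ u′) (toℕ v′) (≤-trans (m≤m+n 13 10) 23≤n)
                      (toℕ<n u) (toℕ<n v) (toℕ<n u′) (toℕ<n v′) (u≢v ∘ toℕ-injective) (u′≢v′ ∘ toℕ-injective)
                      (≡⇒agreeBelow (closer (toℕ u) (toℕ v)) (closer (toℕ u′) (toℕ v′))
                                    (lookup-Xuv u v) (lookup-Xuv u′ v′) X≡X′)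
  in toℕ-injective u≡u′ , toℕ-injective v≡v′
Xuv-injective 23≤n u v u′ v′ _ _ (inj₂ X≡∁X′) =
  ⊥-elim (not-complementary (toℕ u) (toℕ v) (toℕ u′) (toℕ v′) 23≤n
            (≡⇒agreeBelow (closer (toℕ u) (toℕ v)) (not ∘ closer (toℕ u′) (toℕ v′))
                          (lookup-Xuv u v) (lookup-∁Xuv u′ v′) X≡∁X′))

∁-involutive : ∀ {n} (p : Subset n) → ∁ (∁ p) ≡ p
∁-involutive [] = refl
∁-involutive (b ∷ p) = cong₂ _∷_ (not-involutive b) (∁-involutive p)

sameSplit-sym : ∀ {n} {A B : Subset n} → SameSplit A B → SameSplit B A
sameSplit-sym (inj₁ A≡B) = inj₁ (sym A≡B)
sameSplit-sym {B = B} (inj₂ A≡∁B) = inj₂ (trans (sym (∁-involutive B)) (cong ∁ (sym A≡∁B)))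

sameSplit-trans : ∀ {n} {A B C : Subset n} → SameSplit A B → SameSplit B C → SameSplit A C
sameSplit-trans (inj₁ refl) B~C = B~C
sameSplit-trans (inj₂ refl) (inj₁ refl) = inj₂ refl
sameSplit-trans {C = C} (inj₂ refl) (inj₂ refl) = inj₁ (∁-involutive C)

sameSplit? : ∀ {n} (A B : Subset n) → Dec (SameSplit A B)
sameSplit? A B = ≡-dec _≟ᵇ_ A B ⊎-dec ≡-dec _≟ᵇ_ A (∁ B)

splitDecSetoid : ℕ → DecSetoid 0ℓ 0ℓ
splitDecSetoid n = record
  { Carrier          = Subset n
  ; _≈_              = SameSplit
  ; isDecEquivalence = record
    { isEquivalence = record { refl = inj₁ refl ; sym = sameSplit-sym ; trans = sameSplit-trans }
    ; _≟_           = sameSplit?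
    }
  }

length-cartesianProductWith : ∀ {A B C : Set} (f : A → B → C) xs ys →
                              length (cartesianProductWith f xs ys) ≡ length xs * length ys
length-cartesianProductWith f [] ys = refl
length-cartesianProductWith f (x ∷ xs) ys = begin
  length (map (f x) ys ++ cartesianProductWith f xs ys)          ≡⟨ length-++ (map (f x) ys) ⟩
  length (map (f x) ys) + length (cartesianProductWith f xs ys)  ≡⟨ cong₂ _+_ (length-map (f x) ys)
                                                                      (length-cartesianProductWith f xs ys) ⟩
  length ys + length xs * length ys                              ∎
  where open ≡-Reasoning

module _ {m : ℕ} (D : Fin (suc m) → Fin (suc m) → ℚ) where

  -- (u , j) ↦ (u , punchIn u j) enumerates the ordered pairs of distinct points.
  pairSplit : Fin (suc m) → Fin m → Subset (suc m)
  pairSplit u j = Xuv D u (punchIn u j)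

  pairSplits : List (Subset (suc m))
  pairSplits = cartesianProductWith pairSplit (allFin (suc m)) (allFin m)

  length-pairSplits : length pairSplits ≡ suc m * m
  length-pairSplits = trans (length-cartesianProductWith pairSplit (allFin (suc m)) (allFin m))
                            (cong₂ _*_ (length-tabulate {n = suc m} id) (length-tabulate {n = m} id))

  ∈-pairSplits : ∀ {u v} → u ≢ v → Xuv D u v ∈ pairSplits
  ∈-pairSplits {u} u≢v = subst (λ w → Xuv D u w ∈ pairSplits) (punchIn-punchOut u≢v)
    (∈-cartesianProductWith⁺ pairSplit (∈-allFin u) (∈-allFin (punchOut u≢v)))

  ∈-pairSplits⁻ : ∀ {A} → A ∈ pairSplits → ∃[ u ] ∃[ v ] u ≢ v × A ≡ Xuv D u v
  ∈-pairSplits⁻ A∈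
    with u , j , _ , _ , refl ← ∈-cartesianProductWith⁻ pairSplit (allFin (suc m)) (allFin m) A∈ =
    u , punchIn u j , punchInᵢ≢i u j ∘ sym , refl

Nontrivial : ∀ {n} → Subset n → Set
Nontrivial A = Nonempty A × Nonempty (∁ A)

nontrivial? : ∀ {n} (A : Subset n) → Dec (Nontrivial A)
nontrivial? A = nonempty? A ×-dec nonempty? (∁ A)

midpathCard-upper : ∀ {m} (D : Fin (suc m) → Fin (suc m) → ℚ) → ∃[ k ] MidpathCard D k × k ≤ suc m * m
midpathCard-upper {m} D =
  length splits , (splits , refl , All.tabulate sound , unique , complete) , length-bound
  where
  candidates = filter nontrivial? (pairSplits D)
  splits = deduplicate sameSplit? candidates

  length-bound : length splits ≤ suc m * m
  length-bound = begin
    length splits          ≤⟨ length-deduplicate sameSplit? candidates ⟩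
    length candidates      ≤⟨ length-filter nontrivial? (pairSplits D) ⟩
    length (pairSplits D)  ≡⟨ length-pairSplits D ⟩
    suc m * m              ∎
    where open ≤-Reasoning

  sound : ∀ {A} → A ∈ splits → InMidpath D A
  sound A∈
    with A∈pairs , nonempty , nonempty∁ ← ∈-filter⁻ nontrivial? (∈-deduplicate⁻ sameSplit? candidates A∈)
    with u , v , u≢v , refl ← ∈-pairSplits⁻ D A∈pairs = u , v , u≢v , nonempty , nonempty∁ , inj₁ refl

  unique = UniqueDecSetoid.deduplicate-! (splitDecSetoid (suc m)) candidates

  complete : ∀ A → InMidpath D A → Any (SameSplit A) splits
  complete A (u , v , u≢v , nonempty , nonempty∁ , A~X) =
    Any.deduplicate⁺ sameSplit? (λ B~C A~C → sameSplit-trans A~C (sameSplit-sym B~C))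
      (lose (∈-filter⁺ nontrivial? (∈-pairSplits D u≢v) (nonempty , nonempty∁)) A~X)

midpathCard-exact : ∀ {m} → 23 ≤ suc m → MidpathCard (midpathDistance {suc m}) (suc m * m)
midpathCard-exact {m} 23≤n = pairSplits D , length-pairSplits D , All.tabulate sound , unique , complete
  where
  D = midpathDistance {suc m}

  sound : ∀ {A} → A ∈ pairSplits D → InMidpath D A
  sound A∈ with u , v , u≢v , refl ← ∈-pairSplits⁻ D A∈ =
    u , v , u≢v ,
    (u , lookup⇒[]= u _ (trans (lookup-Xuv u v u)
                          (closer-source (toℕ u) (toℕ v) (m≢n⇒0<∣m-n∣ (u≢v ∘ sym ∘ toℕ-injective))))) ,
    (v , lookup⇒[]= v _ (trans (lookup-∁Xuv u v v) (cong not (closer-target (toℕ u) (toℕ v))))) ,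
    inj₁ refl

  pairSplit-injective : ∀ {u u′ j j′} → SameSplit (pairSplit D u j) (pairSplit D u′ j′) → u ≡ u′ × j ≡ j′
  pairSplit-injective {u} {u′} {j} {j′} X~X′ =
    let u≡u′ , v≡v′ = Xuv-injective 23≤n u (punchIn u j) u′ (punchIn u′ j′)
                        (punchInᵢ≢i u j ∘ sym) (punchInᵢ≢i u′ j′ ∘ sym) X~X′
    in u≡u′ , punchIn-injective u j j′ (trans v≡v′ (cong (λ w → punchIn w j′) (sym u≡u′)))

  unique = UniqueSetoid.cartesianProductWith⁺ (≡-setoid (Fin (suc m))) (≡-setoid (Fin m))
             (DecSetoid.setoid (splitDecSetoid (suc m))) (pairSplit D) pairSplit-injective
             (UniquePropositional.allFin⁺ (suc m)) (UniquePropositional.allFin⁺ m)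

  complete : ∀ A → InMidpath D A → Any (SameSplit A) (pairSplits D)
  complete A (u , v , u≢v , _ , _ , A~X) = lose (∈-pairSplits D u≢v) A~X

theorem2 : ((n : ℕ) → 1 ≤ n → (D : Fin n → Fin n → ℚ) → IsDistance D →
               ∃[ k ] (MidpathCard D k × k ≤ n * (n ∸ 1)))
             × (∃[ N ] ∀ n → N ≤ n →
                 ∃[ D ] (IsDistance {n} D × MidpathCard D (n * (n ∸ 1))))
theorem2 = upper , 23 , exact
  where
  upper : (n : ℕ) → 1 ≤ n → (D : Fin n → Fin n → ℚ) → IsDistance D →
          ∃[ k ] (MidpathCard D k × k ≤ n * (n ∸ 1))
  upper (suc m) _ D _ = midpathCard-upper D
  exact : ∀ n → 23 ≤ n → ∃[ D ] (IsDistance {n} D × MidpathCard D (n * (n ∸ 1)))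
  exact (suc m) 23≤n = midpathDistance , midpathDistance-isDistance , midpathCard-exact 23≤n
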